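{- For $n\ge 3$, $$\chi'_{m\Sigma}(K_n)=\begin{cases}3 & \text{if } n \text{ is odd},\\ 4 & \text{if } n \text{ is even and } n\ge 6,\\ 5 & \text{if } n=4.\end{cases}$$
   Context: A $k$-edge-coloring of a graph $G$ is any map $c:E(G)\to[k]$ (adjacent edges may receive the same color). It induces $\sigma_c(v)=\sum_{u\in N(v)}c(vu)$. The coloring is neighbor sum distinguishing (NSD) if $\sigma_c(u)\ne\sigma_c(v)$ for every edge $uv$. It is majority if every vertex $v$ is incident to at most $d(v)/2$ edges of each color. $\chi'_{m\Sigma}(G)$ denotes the minimum $k$ such that $G$ has a $k$-edge-coloring that is both majority and NSD. -}

module Defs where

open import Data.Nat using (ℕ; zero; suc; _+_; _*_; _∸_; _≤_; _≟_)
open import Data.Fin using (Fin)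
import Data.Fin as F
open import Data.List using (List; map; filter; length)
open import Data.Nat.ListAction using (sum)
open import Data.List.Base using (allFin)
open import Data.Product using (_×_; Σ)
open import Relation.Nullary using (¬_; yes; no)
open import Relation.Nullary.Decidable using (¬?; _×-dec_)
open import Relation.Binary.PropositionalEquality using (_≡_; _≢_)

-- The complete graph K_n has vertex set Fin n and an edge between every
-- two distinct vertices.  A k-edge-coloring is represented by a function
-- c : Fin n → Fin n → ℕ with c u v = c v u and 1 ≤ c u v ≤ k whenever
-- u ≢ v (the colour of edge uv); the diagonal values are irrelevant.
Coloring : ℕ → Set
Coloring n = Fin n → Fin n → ℕ

IsEdgeColoring : (n k : ℕ) → Coloring n → Set
IsEdgeColoring n k c =
  (∀ u v → u ≢ v → c u v ≡ c v u) ×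
  (∀ u v → u ≢ v → (1 ≤ c u v) × (c u v ≤ k))

σ : ∀ {n} → Coloring n → Fin n → ℕ
σ {n} c v = sum (map (λ u → c v u) (filter (λ u → ¬? (u F.≟ v)) (allFin n)))

colorDeg : ∀ {n} → Coloring n → Fin n → ℕ → ℕ
colorDeg {n} c v j =
  length (filter (λ u → ¬? (u F.≟ v) ×-dec (c v u ≟ j)) (allFin n))

IsNSD : ∀ {n} → Coloring n → Set
IsNSD {n} c = ∀ (u v : Fin n) → u ≢ v → σ c u ≢ σ c v

IsMajority : ∀ {n} → Coloring n → Set
IsMajority {n} c = ∀ (v : Fin n) (j : ℕ) → 2 * colorDeg c v j ≤ n ∸ 1

HasMajNSD : ℕ → ℕ → Set
HasMajNSD n k = Σ (Coloring n) λ c → IsEdgeColoring n k c × IsMajority c × IsNSD c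

ChiMSigmaK : ℕ → ℕ → Set
ChiMSigmaK n k = HasMajNSD n k × (∀ j → HasMajNSD n j → k ≤ j)

module Submission where

open import Defs
open import Data.Nat
  using (ℕ; zero; suc; _+_; _*_; _∸_; _≤_; _<_; _%_; _/_; z≤n; s≤s; _≟_; _≤?_; _<?_; _≡ᵇ_; ⌊_/2⌋; ⌈_/2⌉)
open import Data.Nat.Properties
open import Data.Nat.DivMod using (m*n%n≡0; m≡m%n+[m/n]*n)
open import Data.Nat.ListAction using (sum)
open import Data.Nat.Tactic.RingSolver using (solve-∀)
open import Algebra.Properties.CommutativeSemigroup +-commutativeSemigroup using (interchange)
open import Data.Bool using (true; false; if_then_else_)
open import Data.Fin using (Fin; toℕ)
import Data.Fin as F
import Data.Fin.Properties as FP
open import Data.List using (List; []; _∷_; map; filter; length; tabulate; allFin; applyUpTo)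
open import Data.List.Properties using (map-applyUpTo; length-map; length-tabulate; map-id; map-tabulate; map-∘)
open import Data.List.Relation.Unary.All using (All; []; _∷_)
import Data.List.Relation.Unary.All as All
open import Data.Vec using (Vec; []; _∷_; lookup)
open import Data.Fin.Properties using (all?)
open import Data.Product using (_×_; _,_; Σ; ∃₂; proj₁; proj₂)
open import Data.Sum using (_⊎_; inj₁; inj₂)
open import Data.Empty using (⊥; ⊥-elim)
open import Function using (_∘_)
open import Relation.Nullary using (¬_; yes; no; does; Dec)
open import Relation.Nullary.Decidable using (¬?; _×-dec_; _→-dec_; True; toWitness)
open import Relation.Unary using (Decidable)
open import Relation.Binary.PropositionalEquality

-- The upper bounds come from colorings built two vertices at a time. Their vertex sums
-- form a zigzag A, C ∸ 1, A + 1, C ∸ 2, A + 2, …: even positions climb from A, odd ones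
-- descend from C, and C ≤ A keeps the two halves apart. Two new vertices U and W are joined
-- to every old vertex by colors adding up to 5 at even and 3 at odd positions, which moves
-- the old sums exactly onto positions 2, 3, … of the zigzag for A + 4 and C + 4, while U and
-- W take its first two values A + 4 and C + 3. Blocks of lengths ⌈m/2⌉ and ⌊m/2⌋ in the
-- colors towards U and W keep every color class at U and W within half the degree. The
-- induction starts from K₁ with 3 colors (odd n) and from an explicit coloring of K₆ with
-- 4 colors (even n); K₄ has an explicit coloring with 5 colors.
--
-- For the lower bounds, a majority coloring of K_{2m+1} with colors 1 and 2 uses each color
-- exactly m times at every vertex, so all sums equal 3m. If a vertex of K_{2m+2} has cᵢ edges
-- of color i ∈ {1, 2, 3}, then σ + c₁ = 2(2m + 1) + c₃, and c₁, c₃ ≤ m confine σ to the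
-- 2m + 1 values 3m + 2, …, 5m + 2, so two of the 2m + 2 vertices share a sum. For K₄ with
-- 4 colors all 4⁶ colorings are checked.

-- Unlike 2 * n, double (suc n) reduces to suc (suc (double n)), as the two-vertex induction needs.
double : ℕ → ℕ
double zero = zero
double (suc n) = suc (suc (double n))

double≡2* : ∀ n → double n ≡ 2 * n
double≡2* zero = refl
double≡2* (suc n) = trans (cong (suc ∘ suc) (double≡2* n)) (sym (*-suc 2 n))

double-cancel-< : ∀ {m n} → double m < double n → m < n
double-cancel-< {zero} {suc n} _ = s≤s z≤n
double-cancel-< {suc m} {suc n} (s≤s (s≤s p)) = s≤s (double-cancel-< p)

2*≤double : ∀ {a b} → a ≤ b → 2 * a ≤ double b
2*≤double {a} {b} a≤b = subst (2 * a ≤_) (sym (double≡2* b)) (*-monoʳ-≤ 2 a≤b)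

half-of-double : ∀ {a m} → 2 * a ≤ double m → a ≤ m
half-of-double {a} {m} p = *-cancelˡ-≤ 2 (subst (2 * a ≤_) (double≡2* m) p)

half-of-suc-double : ∀ {a m} → 2 * a ≤ suc (double m) → a ≤ m
half-of-suc-double {a} {m} p = ≤-pred (*-cancelˡ-< 2 a (suc m) (subst (2 * a <_) (double≡2* (suc m)) (s≤s p)))

parity-split : ∀ n → n ≡ n % 2 + double (n / 2)
parity-split n = trans (m≡m%n+[m/n]*n n 2) (cong (n % 2 +_) (trans (*-comm (n / 2) 2) (sym (double≡2* (n / 2)))))

even⊎odd : ∀ x → (Σ ℕ λ h → x ≡ double h) ⊎ (Σ ℕ λ h → x ≡ suc (double h))
even⊎odd zero = inj₁ (0 , refl)
even⊎odd (suc x) with even⊎odd x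
... | inj₁ (h , refl) = inj₂ (h , refl)
... | inj₂ (h , refl) = inj₁ (suc h , refl)

distinct-of-odd-sum : ∀ {a b s} → s % 2 ≡ 1 → a + b ≡ s → a ≢ b
distinct-of-odd-sum {a} {s = s} s-odd a+b≡s refl = 0≢1+n (begin
  0                ≡⟨ m*n%n≡0 a 2 ⟨
  (a * 2) % 2      ≡⟨ cong (_% 2) (trans (*-comm a 2) (cong (a +_) (+-identityʳ a))) ⟩
  (a + a) % 2      ≡⟨ cong (_% 2) a+b≡s ⟩
  s % 2            ≡⟨ s-odd ⟩
  1                ∎)
  where open ≡-Reasoning

⌈n/2⌉+⌊n/2⌋≡n : ∀ n → ⌈ n /2⌉ + ⌊ n /2⌋ ≡ n
⌈n/2⌉+⌊n/2⌋≡n n = trans (+-comm ⌈ n /2⌉ ⌊ n /2⌋) (⌊n/2⌋+⌈n/2⌉≡n n)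

⌈n/2⌉≤1+⌊n/2⌋ : ∀ n → ⌈ n /2⌉ ≤ suc ⌊ n /2⌋
⌈n/2⌉≤1+⌊n/2⌋ n = ⌊n/2⌋-mono (n≤1+n (suc n))

⌈n/2⌉+⌈n/2⌉≤1+n : ∀ n → ⌈ n /2⌉ + ⌈ n /2⌉ ≤ suc n
⌈n/2⌉+⌈n/2⌉≤1+n n = ≤-trans (+-monoʳ-≤ ⌈ n /2⌉ (⌈n/2⌉≤1+⌊n/2⌋ n))
  (≤-reflexive (trans (+-suc ⌈ n /2⌉ ⌊ n /2⌋) (cong suc (⌈n/2⌉+⌊n/2⌋≡n n))))

⌊n/2⌋+⌊n/2⌋≤n : ∀ n → ⌊ n /2⌋ + ⌊ n /2⌋ ≤ n
⌊n/2⌋+⌊n/2⌋≤n n = ≤-trans (+-monoˡ-≤ ⌊ n /2⌋ (⌊n/2⌋≤⌈n/2⌉ n)) (≤-reflexive (⌈n/2⌉+⌊n/2⌋≡n n))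

-- interleave E O = E 0, O 0, E 1, O 1, …
interleave : (ℕ → ℕ) → (ℕ → ℕ) → ℕ → ℕ
interleave E O zero = E zero
interleave E O (suc x) = interleave O (E ∘ suc) x

interleave-double : ∀ E O h → interleave E O (double h) ≡ E h
interleave-double E O zero = refl
interleave-double E O (suc h) = interleave-double (E ∘ suc) (O ∘ suc) h

interleave-suc-double : ∀ E O h → interleave E O (suc (double h)) ≡ O h
interleave-suc-double E O h = interleave-double O (E ∘ suc) h

interleave-map : ∀ (f : ℕ → ℕ) E O x → f (interleave E O x) ≡ interleave (f ∘ E) (f ∘ O) x
interleave-map f E O zero = refl
interleave-map f E O (suc x) = interleave-map f O (E ∘ suc) x

interleave-zip : ∀ (f : ℕ → ℕ → ℕ) E O E′ O′ x →
  f (interleave E O x) (interleave E′ O′ x) ≡ interleave (λ h → f (E h) (E′ h)) (λ h → f (O h) (O′ h)) x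
interleave-zip f E O E′ O′ zero = refl
interleave-zip f E O E′ O′ (suc x) = interleave-zip f O (E ∘ suc) O′ (E′ ∘ suc) x

interleave-all : ∀ (P : ℕ → Set) {E O} → (∀ h → P (E h)) → (∀ h → P (O h)) → ∀ x → P (interleave E O x)
interleave-all P pE pO zero = pE zero
interleave-all P pE pO (suc x) = interleave-all P pO (pE ∘ suc) x

interleave-cong : ∀ {E O E′ O′} → (∀ h → E h ≡ E′ h) → (∀ h → O h ≡ O′ h) →
  ∀ x → interleave E O x ≡ interleave E′ O′ x
interleave-cong eE eO zero = eE zero
interleave-cong eE eO (suc x) = interleave-cong eO (eE ∘ suc) x

interleave-cong-< : ∀ {E O E′ O′} n →
  (∀ h → double h < n → E h ≡ E′ h) → (∀ h → suc (double h) < n → O h ≡ O′ h) →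
  ∀ x → x < n → interleave E O x ≡ interleave E′ O′ x
interleave-cong-< (suc n) eE eO zero _ = eE zero (s≤s z≤n)
interleave-cong-< (suc n) eE eO (suc x) (s≤s x<n) =
  interleave-cong-< n (λ h p → eO h (s≤s p)) (λ h p → eE (suc h) (s≤s p)) x x<n

threshold : ℕ → ℕ → ℕ → ℕ → ℕ
threshold zero a b q = b
threshold (suc t) a b zero = a
threshold (suc t) a b (suc q) = threshold t a b q

threshold-map : ∀ (f : ℕ → ℕ) t a b q → f (threshold t a b q) ≡ threshold t (f a) (f b) q
threshold-map f zero a b q = refl
threshold-map f (suc t) a b zero = refl
threshold-map f (suc t) a b (suc q) = threshold-map f t a b q

threshold-swap : ∀ t a b q → threshold t a b q + threshold t b a q ≡ a + b
threshold-swap zero a b q = +-comm b a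
threshold-swap (suc t) a b zero = refl
threshold-swap (suc t) a b (suc q) = threshold-swap t a b q

threshold-all : ∀ (P : ℕ → Set) t {a b} → P a → P b → ∀ q → P (threshold t a b q)
threshold-all P zero pa pb q = pb
threshold-all P (suc t) pa pb zero = pa
threshold-all P (suc t) pa pb (suc q) = threshold-all P t pa pb q

infixr 5 _◃_
_◃_ : ℕ → (ℕ → ℕ) → ℕ → ℕ
(a ◃ f) zero = a
(a ◃ f) (suc q) = f q

◃-all : ∀ (P : ℕ → Set) {a g} → P a → (∀ q → P (g q)) → ∀ q → P ((a ◃ g) q)
◃-all P pa pg zero = pa
◃-all P pa pg (suc q) = pg q

sumTo : ℕ → (ℕ → ℕ) → ℕ
sumTo n f = sum (applyUpTo f n)

sumTo-cong : ∀ n {f g} → (∀ x → f x ≡ g x) → sumTo n f ≡ sumTo n g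
sumTo-cong zero eq = refl
sumTo-cong (suc n) eq = cong₂ _+_ (eq 0) (sumTo-cong n (eq ∘ suc))

sumTo-interleave-double : ∀ n E O → sumTo (double n) (interleave E O) ≡ sumTo n E + sumTo n O
sumTo-interleave-double zero E O = refl
sumTo-interleave-double (suc n) E O = begin
  E 0 + (O 0 + sumTo (double n) (interleave (E ∘ suc) (O ∘ suc)))
    ≡⟨ cong (λ s → E 0 + (O 0 + s)) (sumTo-interleave-double n (E ∘ suc) (O ∘ suc)) ⟩
  E 0 + (O 0 + (sumTo n (E ∘ suc) + sumTo n (O ∘ suc)))
    ≡⟨ +-assoc (E 0) (O 0) _ ⟨
  (E 0 + O 0) + (sumTo n (E ∘ suc) + sumTo n (O ∘ suc))
    ≡⟨ interchange (E 0) (O 0) _ _ ⟩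
  (E 0 + sumTo n (E ∘ suc)) + (O 0 + sumTo n (O ∘ suc)) ∎
  where open ≡-Reasoning

sumTo-interleave-suc-double : ∀ n E O → sumTo (suc (double n)) (interleave E O) ≡ sumTo (suc n) E + sumTo n O
sumTo-interleave-suc-double n E O = begin
  E 0 + sumTo (double n) (interleave O (E ∘ suc))  ≡⟨ cong (E 0 +_) (sumTo-interleave-double n O (E ∘ suc)) ⟩
  E 0 + (sumTo n O + sumTo n (E ∘ suc))            ≡⟨ cong (E 0 +_) (+-comm (sumTo n O) _) ⟩
  E 0 + (sumTo n (E ∘ suc) + sumTo n O)            ≡⟨ +-assoc (E 0) _ _ ⟨
  (E 0 + sumTo n (E ∘ suc)) + sumTo n O            ∎
  where open ≡-Reasoning

sum-map-interleave-double : ∀ μ n E O →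
  sum (map μ (applyUpTo (interleave E O) (double n))) ≡ sumTo n (μ ∘ E) + sumTo n (μ ∘ O)
sum-map-interleave-double μ n E O = begin
  sum (map μ (applyUpTo (interleave E O) (double n)))   ≡⟨ cong sum (map-applyUpTo (interleave E O) μ (double n)) ⟩
  sumTo (double n) (μ ∘ interleave E O)                 ≡⟨ sumTo-cong (double n) (interleave-map μ E O) ⟩
  sumTo (double n) (interleave (μ ∘ E) (μ ∘ O))         ≡⟨ sumTo-interleave-double n (μ ∘ E) (μ ∘ O) ⟩
  sumTo n (μ ∘ E) + sumTo n (μ ∘ O)                     ∎
  where open ≡-Reasoning

sum-map-interleave-suc-double : ∀ μ n E O →
  sum (map μ (applyUpTo (interleave E O) (suc (double n)))) ≡ sumTo (suc n) (μ ∘ E) + sumTo n (μ ∘ O)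
sum-map-interleave-suc-double μ n E O = begin
  sum (map μ (applyUpTo (interleave E O) (suc (double n))))   ≡⟨ cong sum (map-applyUpTo (interleave E O) μ (suc (double n))) ⟩
  sumTo (suc (double n)) (μ ∘ interleave E O)                 ≡⟨ sumTo-cong (suc (double n)) (interleave-map μ E O) ⟩
  sumTo (suc (double n)) (interleave (μ ∘ E) (μ ∘ O))         ≡⟨ sumTo-interleave-suc-double n (μ ∘ E) (μ ∘ O) ⟩
  sumTo (suc n) (μ ∘ E) + sumTo n (μ ∘ O)                     ∎
  where open ≡-Reasoning

sumTo-threshold : ∀ t s a b → sumTo (t + s) (threshold t a b) ≡ t * a + s * b
sumTo-threshold zero zero a b = refl
sumTo-threshold zero (suc s) a b = cong (b +_) (sumTo-threshold zero s a b)
sumTo-threshold (suc t) s a b = trans (cong (a +_) (sumTo-threshold t s a b)) (sym (+-assoc a (t * a) (s * b)))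

sumTo-map-threshold : ∀ μ {n} t s a b → n ≡ t + s → sumTo n (μ ∘ threshold t a b) ≡ t * μ a + s * μ b
sumTo-map-threshold μ t s a b refl = trans (sumTo-cong (t + s) (threshold-map μ t a b)) (sumTo-threshold t s (μ a) (μ b))

ValidColor : ℕ → ℕ → Set
ValidColor k x = (1 ≤ x) × (x ≤ k)

valid : ∀ {k x} {1≤x : True (1 ≤? x)} {x≤k : True (x ≤? k)} → ValidColor k x
valid {1≤x = 1≤x} {x≤k} = toWitness 1≤x , toWitness x≤k

neighborColors : ∀ {n} → Coloring n → Fin n → List ℕ
neighborColors {n} c v = map (c v) (filter (λ u → ¬? (u F.≟ v)) (allFin n))

indicator : ℕ → ℕ → ℕ
indicator j x = if x ≡ᵇ j then 1 else 0

count : ℕ → List ℕ → ℕ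
count j xs = sum (map (indicator j) xs)

length-filter-color : ∀ {A : Set} {P : A → Set} (P? : Decidable P) (f : A → ℕ) j xs →
  length (filter (λ u → P? u ×-dec (f u ≟ j)) xs) ≡ count j (map f (filter P? xs))
length-filter-color P? f j [] = refl
length-filter-color P? f j (x ∷ xs) with does (P? x)
... | false = length-filter-color P? f j xs
... | true with does (f x ≟ j)
...   | true = cong suc (length-filter-color P? f j xs)
...   | false = length-filter-color P? f j xs

colorDeg≡count : ∀ {n} (c : Coloring n) v j → colorDeg c v j ≡ count j (neighborColors c v)
colorDeg≡count {n} c v j = length-filter-color (λ u → ¬? (u F.≟ v)) (c v) j (allFin n)

neighborColors-cong : ∀ {n} {c c′ : Coloring n} v → (∀ u → u ≢ v → c v u ≡ c′ v u) →
  neighborColors c v ≡ neighborColors c′ v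
neighborColors-cong {n} {c} {c′} v agree = go (allFin n)
  where
  go : ∀ us → map (c v) (filter (λ u → ¬? (u F.≟ v)) us) ≡ map (c′ v) (filter (λ u → ¬? (u F.≟ v)) us)
  go [] = refl
  go (u ∷ us) with u F.≟ v
  ... | yes _ = go us
  ... | no u≢v = cong₂ _∷_ (agree u u≢v) (go us)

neighborColors-valid : ∀ {n k} {c : Coloring n} → IsEdgeColoring n k c → ∀ v → All (ValidColor k) (neighborColors c v)
neighborColors-valid {n} {k} {c} (_ , valid) v = go (allFin n)
  where
  go : ∀ us → All (ValidColor k) (map (c v) (filter (λ u → ¬? (u F.≟ v)) us))
  go [] = []
  go (u ∷ us) with u F.≟ v
  ... | yes _ = go us
  ... | no u≢v = valid v u (u≢v ∘ sym) ∷ go us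

indicator-self : ∀ j → indicator j j ≡ 1
indicator-self zero = refl
indicator-self (suc j) = indicator-self j

indicator-other : ∀ {j x} → x ≢ j → indicator j x ≡ 0
indicator-other {zero} {zero} x≢j = ⊥-elim (x≢j refl)
indicator-other {zero} {suc x} _ = refl
indicator-other {suc j} {zero} _ = refl
indicator-other {suc j} {suc x} x≢j = indicator-other (x≢j ∘ cong suc)

indicator-distinct : ∀ j {x y} → x ≢ y → indicator j x + indicator j y ≤ 1
indicator-distinct j {x} {y} x≢y with x ≟ j | y ≟ j
... | yes refl | yes refl = ⊥-elim (x≢y refl)
... | yes refl | no y≢j rewrite indicator-self x | indicator-other y≢j = s≤s z≤n
... | no x≢j | yes refl rewrite indicator-other x≢j | indicator-self y = s≤s z≤n
... | no x≢j | no y≢j rewrite indicator-other x≢j | indicator-other y≢j = z≤n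

count-absent : ∀ {j xs} → All (_≢ j) xs → count j xs ≡ 0
count-absent [] = refl
count-absent (x≢j ∷ ps) = cong₂ _+_ (indicator-other x≢j) (count-absent ps)

colorDeg-absent : ∀ {n k j} {c : Coloring n} → IsEdgeColoring n k c → (∀ {x} → ValidColor k x → x ≢ j) →
  ∀ v → colorDeg c v j ≡ 0
colorDeg-absent {j = j} {c} ec outside v =
  trans (colorDeg≡count c v j) (count-absent (All.map outside (neighborColors-valid ec v)))

σ-cong : ∀ {n} {c c′ : Coloring n} → (∀ u v → u ≢ v → c u v ≡ c′ u v) → ∀ v → σ c v ≡ σ c′ v
σ-cong {c = c} {c′} agree v = cong sum (neighborColors-cong {c = c} {c′} v (λ u u≢v → agree v u (u≢v ∘ sym)))

colorDeg-cong : ∀ {n} {c c′ : Coloring n} → (∀ u v → u ≢ v → c u v ≡ c′ u v) →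
  ∀ v j → colorDeg c v j ≡ colorDeg c′ v j
colorDeg-cong {c = c} {c′} agree v j = begin
  colorDeg c v j                  ≡⟨ colorDeg≡count c v j ⟩
  count j (neighborColors c v)    ≡⟨ cong (count j) (neighborColors-cong {c = c} {c′} v (λ u u≢v → agree v u (u≢v ∘ sym))) ⟩
  count j (neighborColors c′ v)   ≡⟨ colorDeg≡count c′ v j ⟨
  colorDeg c′ v j                 ∎
  where open ≡-Reasoning

isEdgeColoring-mono : ∀ {n j k} {c : Coloring n} → j ≤ k → IsEdgeColoring n j c → IsEdgeColoring n k c
isEdgeColoring-mono j≤k (symmetric , valid) =
  symmetric , λ u v u≢v → proj₁ (valid u v u≢v) , ≤-trans (proj₂ (valid u v u≢v)) j≤k

-- xs consists of a ones, b twos, c threes and d fours, in some order.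
record HasProfile (xs : List ℕ) (a b c d : ℕ) : Set where
  constructor profile
  field weighted-sum : ∀ μ → sum (map μ xs) ≡ a * μ 1 + b * μ 2 + c * μ 3 + d * μ 4
open HasProfile

profile-sum : ∀ {xs a b c d} → HasProfile xs a b c d → sum xs ≡ a * 1 + b * 2 + c * 3 + d * 4
profile-sum {xs} p = trans (cong sum (sym (map-id xs))) (weighted-sum p (λ x → x))

profile-majority : ∀ {xs a b c d D} → HasProfile xs a b c d →
  2 * a ≤ D → 2 * b ≤ D → 2 * c ≤ D → 2 * d ≤ D → ∀ j → 2 * count j xs ≤ D
profile-majority {xs} {a} {b} {c} {d} {D} p 2a≤D 2b≤D 2c≤D 2d≤D j =
  subst (λ x → 2 * x ≤ D) (sym (weighted-sum p (indicator j))) (bound j)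
  where
  none : ∀ a b c d → 0 ≡ a * 0 + b * 0 + c * 0 + d * 0
  none = solve-∀
  first : ∀ a b c d → a ≡ a * 1 + b * 0 + c * 0 + d * 0
  first = solve-∀
  second : ∀ a b c d → b ≡ a * 0 + b * 1 + c * 0 + d * 0
  second = solve-∀
  third : ∀ a b c d → c ≡ a * 0 + b * 0 + c * 1 + d * 0
  third = solve-∀
  fourth : ∀ a b c d → d ≡ a * 0 + b * 0 + c * 0 + d * 1
  fourth = solve-∀
  bound : ∀ j → 2 * (a * indicator j 1 + b * indicator j 2 + c * indicator j 3 + d * indicator j 4) ≤ D
  bound 0 = subst (λ x → 2 * x ≤ D) (none a b c d) z≤n
  bound 1 = subst (λ x → 2 * x ≤ D) (first a b c d) 2a≤D
  bound 2 = subst (λ x → 2 * x ≤ D) (second a b c d) 2b≤D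
  bound 3 = subst (λ x → 2 * x ≤ D) (third a b c d) 2c≤D
  bound 4 = subst (λ x → 2 * x ≤ D) (fourth a b c d) 2d≤D
  bound (suc (suc (suc (suc (suc j))))) = subst (λ x → 2 * x ≤ D) (none a b c d) z≤n

-- Adding two vertices

extend : ∀ {n} → Coloring n → (Fin n → ℕ) → Coloring (suc n)
extend c e F.zero F.zero = 0
extend c e F.zero (F.suc v) = e v
extend c e (F.suc u) F.zero = e u
extend c e (F.suc u) (F.suc v) = c u v

filter-≢zero : ∀ {n k} (g : Fin k → Fin n) →
  filter (λ u → ¬? (u F.≟ F.zero)) (tabulate (F.suc ∘ g)) ≡ tabulate (F.suc ∘ g)
filter-≢zero {k = zero} g = refl
filter-≢zero {k = suc k} g = cong (F.suc (g F.zero) ∷_) (filter-≢zero (g ∘ F.suc))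

filter-≢suc : ∀ {n k} (g : Fin k → Fin n) v →
  filter (λ u → ¬? (u F.≟ F.suc v)) (tabulate (F.suc ∘ g)) ≡ map F.suc (filter (λ u → ¬? (u F.≟ v)) (tabulate g))
filter-≢suc {k = zero} g v = refl
filter-≢suc {k = suc k} g v with g F.zero F.≟ v
... | yes _ = filter-≢suc (g ∘ F.suc) v
... | no _ = cong (F.suc (g F.zero) ∷_) (filter-≢suc (g ∘ F.suc) v)

tabulate-toℕ : ∀ n (f : ℕ → ℕ) → tabulate (f ∘ toℕ {n}) ≡ applyUpTo f n
tabulate-toℕ zero f = refl
tabulate-toℕ (suc n) f = cong (f 0 ∷_) (tabulate-toℕ n (f ∘ suc))

neighborColors-extend-zero : ∀ {n} (c : Coloring n) e → neighborColors (extend c e) F.zero ≡ tabulate e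
neighborColors-extend-zero {n} c e =
  trans (cong (map (extend c e F.zero)) (filter-≢zero {n} (λ v → v))) (map-tabulate F.suc (extend c e F.zero))

neighborColors-extend-suc : ∀ {n} (c : Coloring n) e v → neighborColors (extend c e) (F.suc v) ≡ e v ∷ neighborColors c v
neighborColors-extend-suc {n} c e v = cong (e v ∷_) (trans
  (cong (map (extend c e (F.suc v))) (filter-≢suc (λ u → u) v))
  (sym (map-∘ (filter (λ u → ¬? (u F.≟ v)) (allFin n)))))

extend-isEdgeColoring : ∀ {n k} {c : Coloring n} {e} → IsEdgeColoring n k c → (∀ v → ValidColor k (e v)) →
  IsEdgeColoring (suc n) k (extend c e)
extend-isEdgeColoring {c = c} {e} (symmetric , valid) valid-e = symmetric⁺ , valid⁺
  where
  symmetric⁺ : ∀ u v → u ≢ v → extend c e u v ≡ extend c e v u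
  symmetric⁺ F.zero F.zero u≢v = ⊥-elim (u≢v refl)
  symmetric⁺ F.zero (F.suc v) _ = refl
  symmetric⁺ (F.suc u) F.zero _ = refl
  symmetric⁺ (F.suc u) (F.suc v) u≢v = symmetric u v (u≢v ∘ cong F.suc)
  valid⁺ : ∀ u v → u ≢ v → ValidColor _ (extend c e u v)
  valid⁺ F.zero F.zero u≢v = ⊥-elim (u≢v refl)
  valid⁺ F.zero (F.suc v) _ = valid-e v
  valid⁺ (F.suc u) F.zero _ = valid-e u
  valid⁺ (F.suc u) (F.suc v) u≢v = valid u v (u≢v ∘ cong F.suc)

-- The new vertices are U = 0 and W = 1, joined by an edge of color uw; the old vertex v
-- becomes 2 + v and is joined to U and W by the colors u (toℕ v) and w (toℕ v).
module PairExtension {n : ℕ} (c : Coloring (suc n)) (uw : ℕ) (u w : ℕ → ℕ) where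

  uRow : Fin (suc (suc n)) → ℕ
  uRow F.zero = uw
  uRow (F.suc v) = u (toℕ v)

  coloring : Coloring (suc (suc (suc n)))
  coloring = extend (extend c (w ∘ toℕ)) uRow

  colors-U : neighborColors coloring F.zero ≡ uw ∷ applyUpTo u (suc n)
  colors-U = trans (neighborColors-extend-zero _ uRow) (cong (uw ∷_) (tabulate-toℕ (suc n) u))

  colors-W : neighborColors coloring (F.suc F.zero) ≡ uw ∷ applyUpTo w (suc n)
  colors-W = trans (neighborColors-extend-suc _ uRow F.zero)
    (cong (uw ∷_) (trans (neighborColors-extend-zero c (w ∘ toℕ)) (tabulate-toℕ (suc n) w)))

  colors-old : ∀ v → neighborColors coloring (F.suc (F.suc v)) ≡ u (toℕ v) ∷ w (toℕ v) ∷ neighborColors c v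
  colors-old v = trans (neighborColors-extend-suc _ uRow (F.suc v))
    (cong (u (toℕ v) ∷_) (neighborColors-extend-suc c (w ∘ toℕ) v))

  σ-old : ∀ v → σ coloring (F.suc (F.suc v)) ≡ u (toℕ v) + w (toℕ v) + σ c v
  σ-old v = trans (cong sum (colors-old v)) (sym (+-assoc (u (toℕ v)) (w (toℕ v)) (σ c v)))

  isEdgeColoring : ∀ {k} → IsEdgeColoring (suc n) k c → ValidColor k uw →
    (∀ x → ValidColor k (u x)) → (∀ x → ValidColor k (w x)) → IsEdgeColoring (suc (suc (suc n))) k coloring
  isEdgeColoring {k} ec valid-uw valid-u valid-w =
    extend-isEdgeColoring (extend-isEdgeColoring ec (valid-w ∘ toℕ)) valid-uRow
    where
    valid-uRow : ∀ v → ValidColor k (uRow v)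
    valid-uRow F.zero = valid-uw
    valid-uRow (F.suc v) = valid-u (toℕ v)

  isMajority : IsMajority c → (∀ x → u x ≢ w x) →
    (∀ j → 2 * count j (uw ∷ applyUpTo u (suc n)) ≤ suc (suc n)) →
    (∀ j → 2 * count j (uw ∷ applyUpTo w (suc n)) ≤ suc (suc n)) → IsMajority coloring
  isMajority majority u≢w majority-U majority-W = majority⁺
    where
    bound : ∀ a b k → a + b ≤ 1 → 2 * k ≤ n → 2 * (a + (b + k)) ≤ suc (suc n)
    bound a b k a+b≤1 2k≤n = subst (_≤ suc (suc n)) (sym (distribute a b k)) (+-mono-≤ (*-monoʳ-≤ 2 a+b≤1) 2k≤n)
      where
      distribute : ∀ a b k → 2 * (a + (b + k)) ≡ 2 * (a + b) + 2 * k
      distribute = solve-∀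
    through : ∀ v j {xs} → neighborColors coloring v ≡ xs →
      2 * count j xs ≤ suc (suc n) → 2 * colorDeg coloring v j ≤ suc (suc n)
    through v j eq = subst (λ d → 2 * d ≤ suc (suc n)) (sym (trans (colorDeg≡count coloring v j) (cong (count j) eq)))
    majority⁺ : IsMajority coloring
    majority⁺ F.zero j = through F.zero j colors-U (majority-U j)
    majority⁺ (F.suc F.zero) j = through (F.suc F.zero) j colors-W (majority-W j)
    majority⁺ (F.suc (F.suc v)) j = through (F.suc (F.suc v)) j (colors-old v)
      (bound (indicator j (u (toℕ v))) _ _ (indicator-distinct j (u≢w (toℕ v)))
        (subst (λ d → 2 * d ≤ n) (colorDeg≡count c v j) (majority v j)))

-- Zigzag colorings

zigzag : ℕ → ℕ → ℕ → ℕ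
zigzag A C = interleave (_+ A) (λ h → C ∸ suc h)

zigzag-double : ∀ A C h → zigzag A C (double h) ≡ h + A
zigzag-double A C = interleave-double (_+ A) (λ h → C ∸ suc h)

zigzag-suc-double : ∀ A C h → zigzag A C (suc (double h)) ≡ C ∸ suc h
zigzag-suc-double A C = interleave-suc-double (_+ A) (λ h → C ∸ suc h)

zigzag-odd<even : ∀ {A C h′} → C ≤ A → ∀ h → h′ < C → C ∸ suc h′ < h + A
zigzag-odd<even {A} C≤A h h′<C = ≤-trans (∸-monoʳ-< (s≤s z≤n) h′<C) (≤-trans C≤A (m≤n+m A h))

zigzag-injective : ∀ {A C N} → C ≤ A → (∀ h → suc (double h) < N → h < C) →
  ∀ x y → x < N → y < N → zigzag A C x ≡ zigzag A C y → x ≡ y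
zigzag-injective {A} {C} C≤A odd<C x y x<N y<N eq with even⊎odd x | even⊎odd y
... | inj₁ (h , refl) | inj₁ (h′ , refl) =
  cong double (+-cancelʳ-≡ A h h′ (begin
    h + A                       ≡⟨ zigzag-double A C h ⟨
    zigzag A C (double h)       ≡⟨ eq ⟩
    zigzag A C (double h′)      ≡⟨ zigzag-double A C h′ ⟩
    h′ + A                      ∎))
  where open ≡-Reasoning
... | inj₂ (h , refl) | inj₂ (h′ , refl) =
  cong (suc ∘ double) (suc-injective (∸-cancelˡ-≡ (odd<C h x<N) (odd<C h′ y<N) (begin
    C ∸ suc h                   ≡⟨ zigzag-suc-double A C h ⟨
    zigzag A C (suc (double h)) ≡⟨ eq ⟩
    zigzag A C (suc (double h′)) ≡⟨ zigzag-suc-double A C h′ ⟩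
    C ∸ suc h′                  ∎)))
  where open ≡-Reasoning
... | inj₁ (h , refl) | inj₂ (h′ , refl) =
  ⊥-elim (<-irrefl (trans (sym (zigzag-suc-double A C h′)) (trans (sym eq) (zigzag-double A C h)))
                   (zigzag-odd<even C≤A h (odd<C h′ y<N)))
... | inj₂ (h , refl) | inj₁ (h′ , refl) =
  ⊥-elim (<-irrefl (trans (sym (zigzag-suc-double A C h)) (trans eq (zigzag-double A C h′)))
                   (zigzag-odd<even C≤A h′ (odd<C h x<N)))

record ZigzagColoring (k A C : ℕ) {N} (c : Coloring N) : Set where
  field
    isEdgeColoring : IsEdgeColoring N k c
    isMajority : IsMajority c
    σ≡zigzag : ∀ v → σ c v ≡ zigzag A C (toℕ v)

zigzag-isNSD : ∀ {k A C N} {c : Coloring N} → ZigzagColoring k A C c → C ≤ A →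
  (∀ h → suc (double h) < N → h < C) → IsNSD c
zigzag-isNSD z C≤A odd<C u v u≢v σu≡σv =
  u≢v (FP.toℕ-injective (zigzag-injective C≤A odd<C _ _ (FP.toℕ<n u) (FP.toℕ<n v)
    (trans (sym (σ≡zigzag u)) (trans σu≡σv (σ≡zigzag v)))))
  where open ZigzagColoring z

record ZigzagExtension (k n A C uw : ℕ) (u w : ℕ → ℕ) : Set where
  field
    uw-valid : ValidColor k uw
    u-valid : ∀ x → ValidColor k (u x)
    w-valid : ∀ x → ValidColor k (w x)
    u+w : ∀ x → u x + w x ≡ interleave (λ _ → 5) (λ _ → 3) x
    U-majority : ∀ j → 2 * count j (uw ∷ applyUpTo u (suc n)) ≤ suc (suc n)
    W-majority : ∀ j → 2 * count j (uw ∷ applyUpTo w (suc n)) ≤ suc (suc n)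
    U-sum : sum (uw ∷ applyUpTo u (suc n)) ≡ 4 + A
    W-sum : sum (uw ∷ applyUpTo w (suc n)) ≡ 3 + C

zigzag-step : ∀ {k A C n uw u w} {c : Coloring (suc n)} → ZigzagColoring k A C c →
  (∀ h → suc (double h) < suc n → h < C) →
  ZigzagExtension k n A C uw u w → ZigzagColoring k (4 + A) (4 + C) (PairExtension.coloring c uw u w)
zigzag-step {A = A} {C} {n} {uw} {u} {w} {c} z odd<C e = record
  { isEdgeColoring = isEdgeColoring (ZigzagColoring.isEdgeColoring z) uw-valid u-valid w-valid
  ; isMajority = isMajority (ZigzagColoring.isMajority z) u≢w U-majority W-majority
  ; σ≡zigzag = σ⁺
  }
  where
  open ZigzagExtension e
  open PairExtension c uw u w
  u≢w : ∀ x → u x ≢ w x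
  u≢w x = distinct-of-odd-sum (interleave-all (λ s → s % 2 ≡ 1) (λ _ → refl) (λ _ → refl) x) (u+w x)
  shift-even : ∀ h A → 5 + (h + A) ≡ suc h + (4 + A)
  shift-even = solve-∀
  shift-odd : ∀ h → h < C → 3 + (C ∸ suc h) ≡ (4 + C) ∸ suc (suc h)
  shift-odd h h<C = sym (+-∸-assoc 3 h<C)
  σ-shifted : ∀ v → σ coloring (F.suc (F.suc v)) ≡ zigzag (4 + A) (4 + C) (toℕ (F.suc (F.suc v)))
  σ-shifted v = begin
    σ coloring (F.suc (F.suc v))
      ≡⟨ σ-old v ⟩
    u x + w x + σ c v
      ≡⟨ cong₂ _+_ (u+w x) (ZigzagColoring.σ≡zigzag z v) ⟩
    interleave (λ _ → 5) (λ _ → 3) x + zigzag A C x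
      ≡⟨ interleave-zip _+_ (λ _ → 5) (λ _ → 3) (_+ A) (λ h → C ∸ suc h) x ⟩
    interleave (λ h → 5 + (h + A)) (λ h → 3 + (C ∸ suc h)) x
      ≡⟨ interleave-cong-< (suc n) (λ h _ → shift-even h A) (λ h p → shift-odd h (odd<C h p)) x (FP.toℕ<n v) ⟩
    zigzag (4 + A) (4 + C) (suc (suc x)) ∎
    where
    open ≡-Reasoning
    x = toℕ v
  σ⁺ : ∀ v → σ coloring v ≡ zigzag (4 + A) (4 + C) (toℕ v)
  σ⁺ F.zero = trans (cong sum colors-U) U-sum
  σ⁺ (F.suc F.zero) = trans (cong sum colors-W) W-sum
  σ⁺ (F.suc (F.suc v)) = σ-shifted v

-- Upper bounds

fromTable : ∀ {n} → Vec (Vec ℕ n) n → Coloring n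
fromTable t u v = lookup (lookup t u) v

isEdgeColoring? : ∀ n k (c : Coloring n) → Dec (IsEdgeColoring n k c)
isEdgeColoring? n k c =
  (all? λ u → all? λ v → ¬? (u F.≟ v) →-dec (c u v ≟ c v u)) ×-dec
  (all? λ u → all? λ v → ¬? (u F.≟ v) →-dec ((1 ≤? c u v) ×-dec (c u v ≤? k)))

IsMajorityUpTo : ∀ {n} → ℕ → Coloring n → Set
IsMajorityUpTo {n} k c = ∀ v (j : Fin k) → 2 * colorDeg c v (suc (toℕ j)) ≤ n ∸ 1

isMajorityUpTo? : ∀ {n} k (c : Coloring n) → Dec (IsMajorityUpTo k c)
isMajorityUpTo? {n} k c = all? λ v → all? λ j → 2 * colorDeg c v (suc (toℕ j)) ≤? n ∸ 1

isNSD? : ∀ {n} (c : Coloring n) → Dec (IsNSD c)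
isNSD? c = all? λ u → all? λ v → ¬? (u F.≟ v) →-dec ¬? (σ c u ≟ σ c v)

majority-of-upTo : ∀ {n k} {c : Coloring n} → IsEdgeColoring n k c → IsMajorityUpTo k c → IsMajority c
majority-of-upTo {n} {k} {c} ec majority v zero =
  subst (λ d → 2 * d ≤ n ∸ 1) (sym (colorDeg-absent ec (λ (1≤x , _) x≡0 → <⇒≢ 1≤x (sym x≡0)) v)) z≤n
majority-of-upTo {n} {k} {c} ec majority v (suc j) with j <? k
... | yes j<k = subst (λ i → 2 * colorDeg c v (suc i) ≤ n ∸ 1) (FP.toℕ-fromℕ< j<k) (majority v (F.fromℕ< j<k))
... | no j≮k =
  subst (λ d → 2 * d ≤ n ∸ 1) (sym (colorDeg-absent ec (λ (_ , x≤k) x≡1+j → j≮k (subst (_≤ k) x≡1+j x≤k)) v)) z≤n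

module OddScheme (m : ℕ) where

  T r : ℕ
  T = ⌈ m /2⌉
  r = ⌊ m /2⌋

  m≡T+r : m ≡ T + r
  m≡T+r = sym (⌈n/2⌉+⌊n/2⌋≡n m)

  1+m≡T+1+r : suc m ≡ T + suc r
  1+m≡T+1+r = trans (cong suc m≡T+r) (sym (+-suc T r))

  u w : ℕ → ℕ
  u = interleave (threshold T 2 3) (threshold T 2 1)
  w = interleave (threshold T 3 2) (threshold T 1 2)

  U-profile : HasProfile (1 ∷ applyUpTo u (suc (double m))) (suc r) (T + T) (suc r) 0
  U-profile = profile λ μ → begin
    μ 1 + sum (map μ (applyUpTo u (suc (double m))))
      ≡⟨ cong (μ 1 +_) (sum-map-interleave-suc-double μ m (threshold T 2 3) (threshold T 2 1)) ⟩
    μ 1 + (sumTo (suc m) (μ ∘ threshold T 2 3) + sumTo m (μ ∘ threshold T 2 1))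
      ≡⟨ cong (μ 1 +_) (cong₂ _+_ (sumTo-map-threshold μ T (suc r) 2 3 1+m≡T+1+r) (sumTo-map-threshold μ T r 2 1 m≡T+r)) ⟩
    μ 1 + ((T * μ 2 + suc r * μ 3) + (T * μ 2 + r * μ 1))
      ≡⟨ rearrange T r (μ 1) (μ 2) (μ 3) (μ 4) ⟩
    suc r * μ 1 + (T + T) * μ 2 + suc r * μ 3 + 0 * μ 4 ∎
    where
    open ≡-Reasoning
    rearrange : ∀ T r x y z t → x + ((T * y + suc r * z) + (T * y + r * x)) ≡ suc r * x + (T + T) * y + suc r * z + 0 * t
    rearrange = solve-∀

  W-profile : HasProfile (1 ∷ applyUpTo w (suc (double m))) (suc T) (suc r + r) T 0
  W-profile = profile λ μ → begin
    μ 1 + sum (map μ (applyUpTo w (suc (double m))))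
      ≡⟨ cong (μ 1 +_) (sum-map-interleave-suc-double μ m (threshold T 3 2) (threshold T 1 2)) ⟩
    μ 1 + (sumTo (suc m) (μ ∘ threshold T 3 2) + sumTo m (μ ∘ threshold T 1 2))
      ≡⟨ cong (μ 1 +_) (cong₂ _+_ (sumTo-map-threshold μ T (suc r) 3 2 1+m≡T+1+r) (sumTo-map-threshold μ T r 1 2 m≡T+r)) ⟩
    μ 1 + ((T * μ 3 + suc r * μ 2) + (T * μ 1 + r * μ 2))
      ≡⟨ rearrange T r (μ 1) (μ 2) (μ 3) (μ 4) ⟩
    suc T * μ 1 + (suc r + r) * μ 2 + T * μ 3 + 0 * μ 4 ∎
    where
    open ≡-Reasoning
    rearrange : ∀ T r x y z t → x + ((T * z + suc r * y) + (T * x + r * y)) ≡ suc T * x + (suc r + r) * y + T * z + 0 * t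
    rearrange = solve-∀

  extension : ZigzagExtension 3 (double m) (4 * m) (4 * m) 1 u w
  extension = record
    { uw-valid = valid
    ; u-valid = interleave-all (ValidColor 3) (threshold-all (ValidColor 3) T valid valid)
                                              (threshold-all (ValidColor 3) T valid valid)
    ; w-valid = interleave-all (ValidColor 3) (threshold-all (ValidColor 3) T valid valid)
                                              (threshold-all (ValidColor 3) T valid valid)
    ; u+w = λ x → trans (interleave-zip _+_ _ _ _ _ x) (interleave-cong (threshold-swap T 2 3) (threshold-swap T 2 1) x)
    ; U-majority = profile-majority U-profile
        (2*≤double (s≤s (⌊n/2⌋≤n m))) (2*≤double (⌈n/2⌉+⌈n/2⌉≤1+n m)) (2*≤double (s≤s (⌊n/2⌋≤n m))) z≤n
    ; W-majority = profile-majority W-profile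
        (2*≤double (s≤s (⌈n/2⌉≤n m))) (2*≤double (s≤s (⌊n/2⌋+⌊n/2⌋≤n m))) (2*≤double (≤-trans (⌈n/2⌉≤n m) (n≤1+n m))) z≤n
    ; U-sum = trans (profile-sum U-profile) (trans (U-total T r) (cong (λ k → 4 + 4 * k) (sym m≡T+r)))
    ; W-sum = trans (profile-sum W-profile) (trans (W-total T r) (cong (λ k → 3 + 4 * k) (sym m≡T+r)))
    }
    where
    U-total : ∀ T r → suc r * 1 + (T + T) * 2 + suc r * 3 + 0 * 4 ≡ 4 + 4 * (T + r)
    U-total = solve-∀
    W-total : ∀ T r → suc T * 1 + (suc r + r) * 2 + T * 3 + 0 * 4 ≡ 3 + 4 * (T + r)
    W-total = solve-∀

odd-positions-below : ∀ {h m C} → suc (double h) < suc (double m) → m ≤ C → h < C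
odd-positions-below p m≤C = ≤-trans (double-cancel-< (≤-pred p)) m≤C

oddZigzagColoring : ∀ m → Σ (Coloring (suc (double m))) (ZigzagColoring 3 (4 * m) (4 * m))
oddZigzagColoring zero = (λ _ _ → 1) , record
  { isEdgeColoring = (λ { F.zero F.zero 0≢0 → ⊥-elim (0≢0 refl) }) , (λ { F.zero F.zero 0≢0 → ⊥-elim (0≢0 refl) })
  ; isMajority = λ { F.zero j → z≤n }
  ; σ≡zigzag = λ { F.zero → refl }
  }
oddZigzagColoring (suc m) with oddZigzagColoring m
... | c , z = c⁺ , subst₂ (λ A C → ZigzagColoring 3 A C c⁺) (sym (*-suc 4 m)) (sym (*-suc 4 m))
  (zigzag-step z (λ h p → odd-positions-below p (m≤n*m m 4)) (OddScheme.extension m))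
  where
  c⁺ : Coloring (suc (double (suc m)))
  c⁺ = PairExtension.coloring c 1 (OddScheme.u m) (OddScheme.w m)

odd-hasMajNSD-3 : ∀ m → HasMajNSD (suc (double m)) 3
odd-hasMajNSD-3 m with oddZigzagColoring m
... | c , z = c , isEdgeColoring , isMajority , zigzag-isNSD z ≤-refl (λ h p → odd-positions-below p (m≤n*m m 4))
  where open ZigzagColoring z

module EvenScheme (k : ℕ) where

  T r : ℕ
  T = ⌈ k /2⌉
  r = ⌊ k /2⌋

  k≡T+r : k ≡ T + r
  k≡T+r = sym (⌈n/2⌉+⌊n/2⌋≡n k)

  u w : ℕ → ℕ
  u = interleave (1 ◃ threshold r 2 3) (threshold T 1 2)
  w = interleave (4 ◃ threshold r 3 2) (threshold T 2 1)

  2+k≡r+2+T : 2 + k ≡ r + (2 + T)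
  2+k≡r+2+T = trans (cong (2 +_) k≡T+r) (shuffle T r)
    where
    shuffle : ∀ T r → 2 + (T + r) ≡ r + (2 + T)
    shuffle = solve-∀

  3+k≡T+3+r : 3 + k ≡ T + (3 + r)
  3+k≡T+3+r = trans (cong (3 +_) k≡T+r) (shuffle T r)
    where
    shuffle : ∀ T r → 3 + (T + r) ≡ T + (3 + r)
    shuffle = solve-∀

  U-profile : HasProfile (4 ∷ applyUpTo u (double (3 + k))) (suc T) (3 + (r + r)) (2 + T) 1
  U-profile = profile λ μ → begin
    μ 4 + sum (map μ (applyUpTo u (double (3 + k))))
      ≡⟨ cong (μ 4 +_) (sum-map-interleave-double μ (3 + k) (1 ◃ threshold r 2 3) (threshold T 1 2)) ⟩
    μ 4 + ((μ 1 + sumTo (2 + k) (μ ∘ threshold r 2 3)) + sumTo (3 + k) (μ ∘ threshold T 1 2))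
      ≡⟨ cong (μ 4 +_) (cong₂ _+_ (cong (μ 1 +_) (sumTo-map-threshold μ r (2 + T) 2 3 2+k≡r+2+T))
                                  (sumTo-map-threshold μ T (3 + r) 1 2 3+k≡T+3+r)) ⟩
    μ 4 + ((μ 1 + (r * μ 2 + (2 + T) * μ 3)) + (T * μ 1 + (3 + r) * μ 2))
      ≡⟨ rearrange T r (μ 1) (μ 2) (μ 3) (μ 4) ⟩
    suc T * μ 1 + (3 + (r + r)) * μ 2 + (2 + T) * μ 3 + 1 * μ 4 ∎
    where
    open ≡-Reasoning
    rearrange : ∀ T r x y z t → t + ((x + (r * y + (2 + T) * z)) + (T * x + (3 + r) * y))
                              ≡ suc T * x + (3 + (r + r)) * y + (2 + T) * z + 1 * t
    rearrange = solve-∀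

  W-profile : HasProfile (4 ∷ applyUpTo w (double (3 + k))) (3 + r) (2 + (T + T)) r 2
  W-profile = profile λ μ → begin
    μ 4 + sum (map μ (applyUpTo w (double (3 + k))))
      ≡⟨ cong (μ 4 +_) (sum-map-interleave-double μ (3 + k) (4 ◃ threshold r 3 2) (threshold T 2 1)) ⟩
    μ 4 + ((μ 4 + sumTo (2 + k) (μ ∘ threshold r 3 2)) + sumTo (3 + k) (μ ∘ threshold T 2 1))
      ≡⟨ cong (μ 4 +_) (cong₂ _+_ (cong (μ 4 +_) (sumTo-map-threshold μ r (2 + T) 3 2 2+k≡r+2+T))
                                  (sumTo-map-threshold μ T (3 + r) 2 1 3+k≡T+3+r)) ⟩
    μ 4 + ((μ 4 + (r * μ 3 + (2 + T) * μ 2)) + (T * μ 2 + (3 + r) * μ 1))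
      ≡⟨ rearrange T r (μ 1) (μ 2) (μ 3) (μ 4) ⟩
    (3 + r) * μ 1 + (2 + (T + T)) * μ 2 + r * μ 3 + 2 * μ 4 ∎
    where
    open ≡-Reasoning
    rearrange : ∀ T r x y z t → t + ((t + (r * z + (2 + T) * y)) + (T * y + (3 + r) * x))
                              ≡ (3 + r) * x + (2 + (T + T)) * y + r * z + 2 * t
    rearrange = solve-∀

  extension : ZigzagExtension 4 (suc (double (2 + k))) (13 + 4 * k) (12 + 4 * k) 4 u w
  extension = record
    { uw-valid = valid
    ; u-valid = interleave-all (ValidColor 4) (◃-all (ValidColor 4) valid (threshold-all (ValidColor 4) r valid valid))
                                               (threshold-all (ValidColor 4) T valid valid)
    ; w-valid = interleave-all (ValidColor 4) (◃-all (ValidColor 4) valid (threshold-all (ValidColor 4) r valid valid))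
                                               (threshold-all (ValidColor 4) T valid valid)
    ; u+w = λ x → trans (interleave-zip _+_ _ _ _ _ x) (interleave-cong even-sum (threshold-swap T 1 2) x)
    ; U-majority = profile-majority U-profile
        (below (s≤s (≤-trans (⌈n/2⌉≤n k) (m≤n+m k 2)))) (below (+-monoʳ-≤ 3 (⌊n/2⌋+⌊n/2⌋≤n k)))
        (below (s≤s (s≤s (≤-trans (⌈n/2⌉≤n k) (n≤1+n k))))) (below (s≤s z≤n))
    ; W-majority = profile-majority W-profile
        (below (+-monoʳ-≤ 3 (⌊n/2⌋≤n k))) (below (s≤s (s≤s (⌈n/2⌉+⌈n/2⌉≤1+n k))))
        (below (≤-trans (⌊n/2⌋≤n k) (m≤n+m k 3))) (below (s≤s (s≤s z≤n)))
    ; U-sum = trans (profile-sum U-profile) (trans (U-total T r) (cong (λ n → 4 + (13 + 4 * n)) (sym k≡T+r)))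
    ; W-sum = trans (profile-sum W-profile) (trans (W-total T r) (cong (λ n → 3 + (12 + 4 * n)) (sym k≡T+r)))
    }
    where
    below : ∀ {a} → a ≤ 3 + k → 2 * a ≤ suc (double (3 + k))
    below a≤ = ≤-trans (2*≤double a≤) (n≤1+n _)
    even-sum : ∀ h → (1 ◃ threshold r 2 3) h + (4 ◃ threshold r 3 2) h ≡ 5
    even-sum zero = refl
    even-sum (suc h) = threshold-swap r 2 3 h
    U-total : ∀ T r → suc T * 1 + (3 + (r + r)) * 2 + (2 + T) * 3 + 1 * 4 ≡ 4 + (13 + 4 * (T + r))
    U-total = solve-∀
    W-total : ∀ T r → (3 + r) * 1 + (2 + (T + T)) * 2 + r * 3 + 2 * 4 ≡ 3 + (12 + 4 * (T + r))
    W-total = solve-∀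

coloringK6 : Coloring 6
coloringK6 = fromTable
  ( (0 ∷ 1 ∷ 2 ∷ 3 ∷ 4 ∷ 3 ∷ [])
  ∷ (1 ∷ 0 ∷ 4 ∷ 1 ∷ 3 ∷ 2 ∷ [])
  ∷ (2 ∷ 4 ∷ 0 ∷ 3 ∷ 4 ∷ 1 ∷ [])
  ∷ (3 ∷ 1 ∷ 3 ∷ 0 ∷ 2 ∷ 1 ∷ [])
  ∷ (4 ∷ 3 ∷ 4 ∷ 2 ∷ 0 ∷ 2 ∷ [])
  ∷ (3 ∷ 2 ∷ 1 ∷ 1 ∷ 2 ∷ 0 ∷ [])
  ∷ [])

coloringK6-zigzag : ZigzagColoring 4 13 12 coloringK6
coloringK6-zigzag = record
  { isEdgeColoring = coloringK6-isEdgeColoring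
  ; isMajority = majority-of-upTo coloringK6-isEdgeColoring (toWitness {a? = isMajorityUpTo? 4 coloringK6} _)
  ; σ≡zigzag = toWitness {a? = all? λ v → σ coloringK6 v ≟ zigzag 13 12 (toℕ v)} _
  }
  where
  coloringK6-isEdgeColoring : IsEdgeColoring 6 4 coloringK6
  coloringK6-isEdgeColoring = toWitness {a? = isEdgeColoring? 6 4 coloringK6} _

even-positions-below : ∀ {h k} → suc (double h) < double (3 + k) → h < 12 + 4 * k
even-positions-below {k = k} p =
  ≤-trans (double-cancel-< (≤-trans (n≤1+n _) p)) (+-mono-≤ {3} {12} (s≤s (s≤s (s≤s z≤n))) (m≤n*m k 4))

evenZigzagColoring : ∀ k → Σ (Coloring (double (3 + k))) (ZigzagColoring 4 (13 + 4 * k) (12 + 4 * k))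
evenZigzagColoring zero = coloringK6 , coloringK6-zigzag
evenZigzagColoring (suc k) with evenZigzagColoring k
... | c , z = c⁺ ,
  subst₂ (λ A C → ZigzagColoring 4 A C c⁺) (cong (13 +_) (sym (*-suc 4 k))) (cong (12 +_) (sym (*-suc 4 k)))
  (zigzag-step z (λ h → even-positions-below) (EvenScheme.extension k))
  where
  c⁺ : Coloring (double (3 + suc k))
  c⁺ = PairExtension.coloring c 4 (EvenScheme.u k) (EvenScheme.w k)

even-hasMajNSD-4 : ∀ k → HasMajNSD (double (3 + k)) 4
even-hasMajNSD-4 k with evenZigzagColoring k
... | c , z = c , isEdgeColoring , isMajority , zigzag-isNSD z (n≤1+n _) (λ h → even-positions-below)
  where open ZigzagColoring z

coloringK4 : ℕ → ℕ → ℕ → ℕ → ℕ → ℕ → Coloring 4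
coloringK4 a b c d e f = fromTable
  ( (0 ∷ a ∷ b ∷ c ∷ [])
  ∷ (a ∷ 0 ∷ d ∷ e ∷ [])
  ∷ (b ∷ d ∷ 0 ∷ f ∷ [])
  ∷ (c ∷ e ∷ f ∷ 0 ∷ [])
  ∷ [])

K4-hasMajNSD-5 : HasMajNSD 4 5
K4-hasMajNSD-5 = K , ec , majority-of-upTo ec (toWitness {a? = isMajorityUpTo? 5 K} _) , toWitness {a? = isNSD? K} _
  where
  K = coloringK4 1 2 3 3 4 5
  ec : IsEdgeColoring 4 5 K
  ec = toWitness {a? = isEdgeColoring? 4 5 K} _

-- Lower bounds

pattern v₀ = F.zero
pattern v₁ = F.suc F.zero
pattern v₂ = F.suc (F.suc F.zero)
pattern v₃ = F.suc (F.suc (F.suc F.zero))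

length-filter-≢ : ∀ {n} (v : Fin n) → length (filter (λ u → ¬? (u F.≟ v)) (allFin n)) ≡ n ∸ 1
length-filter-≢ {suc n} F.zero = trans (cong length (filter-≢zero {n} (λ u → u))) (length-tabulate F.suc)
length-filter-≢ {suc (suc n)} (F.suc v) = cong suc (begin
  length (filter (λ u → ¬? (u F.≟ F.suc v)) (tabulate F.suc)) ≡⟨ cong length (filter-≢suc (λ u → u) v) ⟩
  length (map F.suc others)                                    ≡⟨ length-map F.suc others ⟩
  length others                                                ≡⟨ length-filter-≢ v ⟩
  n                                                            ∎)
  where
  open ≡-Reasoning
  others = filter (λ u → ¬? (u F.≟ v)) (allFin (suc n))

length-neighborColors : ∀ {n} (c : Coloring n) v → length (neighborColors c v) ≡ n ∸ 1
length-neighborColors {n} c v = trans (length-map (c v) (filter (λ u → ¬? (u F.≟ v)) (allFin n))) (length-filter-≢ v)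

sum-map-const-1 : ∀ (xs : List ℕ) → sum (map (λ _ → 1) xs) ≡ length xs
sum-map-const-1 [] = refl
sum-map-const-1 (x ∷ xs) = cong suc (sum-map-const-1 xs)

color-counts : ∀ {xs} → All (ValidColor 3) xs → HasProfile xs (count 1 xs) (count 2 xs) (count 3 xs) 0
color-counts [] = profile λ μ → refl
color-counts {x ∷ xs} (x-valid ∷ valid) =
  profile λ μ → trans (cong (μ x +_) (weighted-sum (color-counts valid) μ)) (step x-valid μ)
  where
  c₁ = count 1 xs ; c₂ = count 2 xs ; c₃ = count 3 xs
  step : ValidColor 3 x → ∀ μ → μ x + (c₁ * μ 1 + c₂ * μ 2 + c₃ * μ 3 + 0 * μ 4)
    ≡ count 1 (x ∷ xs) * μ 1 + count 2 (x ∷ xs) * μ 2 + count 3 (x ∷ xs) * μ 3 + 0 * μ 4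
  step (s≤s z≤n , s≤s z≤n) μ = first c₁ c₂ c₃ (μ 1) (μ 2) (μ 3) (μ 4)
    where first : ∀ c₁ c₂ c₃ a b c d → a + (c₁ * a + c₂ * b + c₃ * c + 0 * d) ≡ suc c₁ * a + c₂ * b + c₃ * c + 0 * d
          first = solve-∀
  step (s≤s z≤n , s≤s (s≤s z≤n)) μ = second c₁ c₂ c₃ (μ 1) (μ 2) (μ 3) (μ 4)
    where second : ∀ c₁ c₂ c₃ a b c d → b + (c₁ * a + c₂ * b + c₃ * c + 0 * d) ≡ c₁ * a + suc c₂ * b + c₃ * c + 0 * d
          second = solve-∀
  step (s≤s z≤n , s≤s (s≤s (s≤s z≤n))) μ = third c₁ c₂ c₃ (μ 1) (μ 2) (μ 3) (μ 4)
    where third : ∀ c₁ c₂ c₃ a b c d → c + (c₁ * a + c₂ * b + c₃ * c + 0 * d) ≡ c₁ * a + c₂ * b + suc c₃ * c + 0 * d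
          third = solve-∀

color-classes : ∀ {n} {c : Coloring n} → IsEdgeColoring n 3 c → ∀ v →
  (colorDeg c v 1 + colorDeg c v 2 + colorDeg c v 3 ≡ n ∸ 1) ×
  (σ c v ≡ colorDeg c v 1 * 1 + colorDeg c v 2 * 2 + colorDeg c v 3 * 3 + 0 * 4)
color-classes {n} {c} ec v
  rewrite colorDeg≡count c v 1 | colorDeg≡count c v 2 | colorDeg≡count c v 3 =
  trans (unit-weights (count 1 xs) (count 2 xs) (count 3 xs))
        (trans (sym (weighted-sum counts (λ _ → 1))) (trans (sum-map-const-1 xs) (length-neighborColors c v))) ,
  profile-sum counts
  where
  xs = neighborColors c v
  counts = color-counts (neighborColors-valid ec v)
  unit-weights : ∀ a b c → a + b + c ≡ a * 1 + b * 1 + c * 1 + 0 * 1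
  unit-weights = solve-∀

color-sum-balanced : ∀ {m a b c} → a + b + c ≡ double m → c ≡ 0 → a ≤ m → b ≤ m → a * 1 + b * 2 + c * 3 + 0 * 4 ≡ 3 * m
color-sum-balanced {m} {a} {b} a+b≡2m refl a≤m b≤m = begin
  a * 1 + b * 2 + 0 * 3 + 0 * 4   ≡⟨ cong₂ (λ x y → x * 1 + y * 2 + 0 * 3 + 0 * 4) a≡m b≡m ⟩
  m * 1 + m * 2 + 0 * 3 + 0 * 4   ≡⟨ three-halves m ⟩
  3 * m                           ∎
  where
  open ≡-Reasoning
  three-halves : ∀ m → m * 1 + m * 2 + 0 * 3 + 0 * 4 ≡ 3 * m
  three-halves = solve-∀
  a+b≡m+m : a + b ≡ m + m
  a+b≡m+m = trans (sym (+-identityʳ (a + b))) (trans a+b≡2m (trans (double≡2* m) (cong (m +_) (+-identityʳ m))))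
  a≡m : a ≡ m
  a≡m = ≤-antisym a≤m (+-cancelʳ-≤ m m a (subst (_≤ a + m) a+b≡m+m (+-monoʳ-≤ a b≤m)))
  b≡m : b ≡ m
  b≡m = ≤-antisym b≤m (+-cancelˡ-≤ m m b (subst (_≤ m + b) a+b≡m+m (+-monoˡ-≤ b a≤m)))

odd-¬hasMajNSD-2 : ∀ m → ¬ HasMajNSD (suc (double (suc m))) 2
odd-¬hasMajNSD-2 m (c , ec , majority , nsd) = nsd v₀ v₁ (λ ()) (trans (σ≡3m v₀) (sym (σ≡3m v₁)))
  where
  σ≡3m : ∀ v → σ c v ≡ 3 * suc m
  σ≡3m v with color-classes (isEdgeColoring-mono (n≤1+n 2) ec) v
  ... | degree , σ≡ = trans σ≡ (color-sum-balanced degree no-third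
          (half-of-double {colorDeg c v 1} (majority v 1)) (half-of-double {colorDeg c v 2} (majority v 2)))
    where
    no-third : colorDeg c v 3 ≡ 0
    no-third = colorDeg-absent ec (λ (_ , x≤2) x≡3 → <-irrefl x≡3 (s≤s x≤2)) v

color-sum-bounds : ∀ {m a b c} → a + b + c ≡ suc (double m) → a ≤ m → c ≤ m →
  (3 * m + 2 ≤ a * 1 + b * 2 + c * 3 + 0 * 4) × (a * 1 + b * 2 + c * 3 + 0 * 4 ≤ 3 * m + 2 + double m)
color-sum-bounds {m} {a} {b} {c} total a≤m c≤m = lower , upper
  where
  open ≤-Reasoning
  s = a * 1 + b * 2 + c * 3 + 0 * 4
  D = 2 * suc (double m)
  s+a≡D+c : s + a ≡ D + c
  s+a≡D+c = trans (key a b c) (cong (λ t → 2 * t + c) total)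
    where
    key : ∀ a b c → a * 1 + b * 2 + c * 3 + 0 * 4 + a ≡ 2 * (a + b + c) + c
    key = solve-∀
  L+m≡D : 3 * m + 2 + m ≡ D
  L+m≡D = trans (arith m) (cong (λ d → 2 * suc d) (sym (double≡2* m)))
    where
    arith : ∀ m → 3 * m + 2 + m ≡ 2 * suc (2 * m)
    arith = solve-∀
  D+m≡L+2m : D + m ≡ 3 * m + 2 + double m
  D+m≡L+2m = trans (cong (λ d → 2 * suc d + m) (double≡2* m)) (trans (arith m) (cong (3 * m + 2 +_) (sym (double≡2* m))))
    where
    arith : ∀ m → 2 * suc (2 * m) + m ≡ 3 * m + 2 + 2 * m
    arith = solve-∀
  lower : 3 * m + 2 ≤ s
  lower = +-cancelʳ-≤ m (3 * m + 2) s (begin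
    3 * m + 2 + m   ≡⟨ L+m≡D ⟩
    D               ≤⟨ m≤m+n D c ⟩
    D + c           ≡⟨ s+a≡D+c ⟨
    s + a           ≤⟨ +-monoʳ-≤ s a≤m ⟩
    s + m           ∎)
  upper : s ≤ 3 * m + 2 + double m
  upper = begin
    s                    ≤⟨ m≤m+n s a ⟩
    s + a                ≡⟨ s+a≡D+c ⟩
    D + c                ≤⟨ +-monoʳ-≤ D c≤m ⟩
    D + m                ≡⟨ D+m≡L+2m ⟩
    3 * m + 2 + double m ∎

even-¬hasMajNSD-3 : ∀ m → ¬ HasMajNSD (double (suc m)) 3
even-¬hasMajNSD-3 m (c , ec , majority , nsd) = collision (FP.pigeonhole (n<1+n (suc (double m))) shift)
  where
  L = 3 * m + 2
  bounds : ∀ v → (L ≤ σ c v) × (σ c v ≤ L + double m)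
  bounds v with color-classes ec v
  ... | degree , σ≡ = subst (λ s → (L ≤ s) × (s ≤ L + double m)) (sym σ≡)
    (color-sum-bounds degree (half-of-suc-double {colorDeg c v 1} (majority v 1))
                             (half-of-suc-double {colorDeg c v 3} (majority v 3)))
  shift<2m+1 : ∀ v → σ c v ∸ L < suc (double m)
  shift<2m+1 v = s≤s (subst (σ c v ∸ L ≤_) (m+n∸m≡n L (double m)) (∸-monoˡ-≤ L (proj₂ (bounds v))))
  shift : Fin (double (suc m)) → Fin (suc (double m))
  shift v = F.fromℕ< (shift<2m+1 v)
  collision : ∃₂ (λ i j → i F.< j × shift i ≡ shift j) → ⊥
  collision (i , j , i<j , same) = nsd i j (FP.<⇒≢ i<j) (∸-cancelʳ-≡ (proj₁ (bounds i)) (proj₁ (bounds j))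
    (trans (sym (FP.toℕ-fromℕ< (shift<2m+1 i))) (trans (cong toℕ same) (FP.toℕ-fromℕ< (shift<2m+1 j)))))

color-code : ∀ {k x} → ValidColor k x → Σ (Fin k) λ i → x ≡ suc (toℕ i)
color-code {x = suc x} (_ , x<k) = F.fromℕ< x<k , cong suc (sym (FP.toℕ-fromℕ< x<k))

coloringK4-agrees : ∀ {k a b c′ d e f} {c : Coloring 4} → IsEdgeColoring 4 k c →
  c v₀ v₁ ≡ a → c v₀ v₂ ≡ b → c v₀ v₃ ≡ c′ → c v₁ v₂ ≡ d → c v₁ v₃ ≡ e → c v₂ v₃ ≡ f →
  ∀ u v → u ≢ v → c u v ≡ coloringK4 a b c′ d e f u v
coloringK4-agrees (symmetric , _) e₀₁ e₀₂ e₀₃ e₁₂ e₁₃ e₂₃ = λ where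
  v₀ v₁ _ → e₀₁
  v₀ v₂ _ → e₀₂
  v₀ v₃ _ → e₀₃
  v₁ v₂ _ → e₁₂
  v₁ v₃ _ → e₁₃
  v₂ v₃ _ → e₂₃
  v₁ v₀ _ → trans (symmetric v₁ v₀ (λ ())) e₀₁
  v₂ v₀ _ → trans (symmetric v₂ v₀ (λ ())) e₀₂
  v₃ v₀ _ → trans (symmetric v₃ v₀ (λ ())) e₀₃
  v₂ v₁ _ → trans (symmetric v₂ v₁ (λ ())) e₁₂
  v₃ v₁ _ → trans (symmetric v₃ v₁ (λ ())) e₁₃
  v₃ v₂ _ → trans (symmetric v₃ v₂ (λ ())) e₂₃
  v₀ v₀ u≢u → ⊥-elim (u≢u refl)
  v₁ v₁ u≢u → ⊥-elim (u≢u refl)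
  v₂ v₂ u≢u → ⊥-elim (u≢u refl)
  v₃ v₃ u≢u → ⊥-elim (u≢u refl)

color : Fin 4 → ℕ
color i = suc (toℕ i)

no-majority-NSD-K4 : ∀ a b c d e f → let K = coloringK4 (color a) (color b) (color c) (color d) (color e) (color f) in
  ¬ (IsMajorityUpTo 4 K × IsNSD K)
no-majority-NSD-K4 = toWitness {a? = all? λ a → all? λ b → all? λ c → all? λ d → all? λ e → all? λ f →
  let K = coloringK4 (color a) (color b) (color c) (color d) (color e) (color f) in ¬? (isMajorityUpTo? 4 K ×-dec isNSD? K)} _

K4-¬hasMajNSD-4 : ¬ HasMajNSD 4 4
K4-¬hasMajNSD-4 (c , ec , majority , nsd)
  with color-code (proj₂ ec v₀ v₁ (λ ())) | color-code (proj₂ ec v₀ v₂ (λ ())) | color-code (proj₂ ec v₀ v₃ (λ ()))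
     | color-code (proj₂ ec v₁ v₂ (λ ())) | color-code (proj₂ ec v₁ v₃ (λ ())) | color-code (proj₂ ec v₂ v₃ (λ ()))
... | a , e₀₁ | b , e₀₂ | c′ , e₀₃ | d , e₁₂ | e , e₁₃ | f , e₂₃ = no-majority-NSD-K4 a b c′ d e f
  ( (λ v j → subst (λ x → 2 * x ≤ 3) (colorDeg-cong agree v (color j)) (majority v (color j)))
  , (λ u v u≢v σu≡σv → nsd u v u≢v (trans (σ-cong agree u) (trans σu≡σv (sym (σ-cong agree v))))) )
  where
  agree = coloringK4-agrees ec e₀₁ e₀₂ e₀₃ e₁₂ e₁₃ e₂₃

HasMajNSD-mono : ∀ {n j k} → j ≤ k → HasMajNSD n j → HasMajNSD n k
HasMajNSD-mono j≤k (c , ec , majority , nsd) = c , isEdgeColoring-mono j≤k ec , majority , nsd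

chi-intro : ∀ {n k} → HasMajNSD n (suc k) → ¬ HasMajNSD n k → ChiMSigmaK n (suc k)
chi-intro has none = has , λ j hasⱼ → ≰⇒> (λ j≤k → none (HasMajNSD-mono j≤k hasⱼ))

chi-odd : ∀ {n} h → 3 ≤ n → n ≡ suc (double h) → ChiMSigmaK n 3
chi-odd zero (s≤s (s≤s _)) ()
chi-odd (suc h) _ refl = chi-intro (odd-hasMajNSD-3 (suc h)) (odd-¬hasMajNSD-2 h)

chi-even : ∀ {n} h → 6 ≤ n → n ≡ double h → ChiMSigmaK n 4
chi-even (suc (suc (suc k))) _ refl = chi-intro (even-hasMajNSD-4 k) (even-¬hasMajNSD-3 (suc (suc k)))
chi-even zero () refl
chi-even (suc zero) (s≤s (s≤s ())) refl
chi-even (suc (suc zero)) (s≤s (s≤s (s≤s (s≤s ())))) refl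

mainTheorem8 : (n : ℕ) → 3 ≤ n →
    ((n % 2 ≡ 1 → ChiMSigmaK n 3) ×
     (n % 2 ≡ 0 → 6 ≤ n → ChiMSigmaK n 4) ×
     (n ≡ 4 → ChiMSigmaK n 5))
mainTheorem8 n 3≤n =
  (λ odd → chi-odd (n / 2) 3≤n (trans (parity-split n) (cong (_+ double (n / 2)) odd))) ,
  (λ even 6≤n → chi-even (n / 2) 6≤n (trans (parity-split n) (cong (_+ double (n / 2)) even))) ,
  (λ { refl → chi-intro K4-hasMajNSD-5 K4-¬hasMajNSD-4 })
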